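{- Let $\rho,\tau,\varphi,\psi$ be order types such that $\rho$ and $\varphi$ are not both $0$. If $\rho\tau\leqslant\varphi\psi$, then either ($1+\rho\leqslant\varphi$ and $\rho+1\leqslant\varphi$) or $\tau\leqslant\psi$.
   Context: Work in ZFC. Order types are isomorphism classes of linear orders; $0$ is the empty type and $1$ the one-point type. $\varphi\leqslant\psi$ means an order of type $\varphi$ embeds in one of type $\psi$. The sum $\psi+\tau$ is a copy of $\psi$ followed by a copy of $\tau$. For linear orders $Y,X$, the product $YX$ is $Y\times X$ ordered anti-lexicographically ($(y,x)<(y',x')$ iff $x<x'$, or $x=x'$ and $y<y'$), i.e. $X$ with each point replaced by a copy of $Y$; $\rho\tau$ is the type of such a product. -}

module Defs where

open import Level using (0ℓ)
open import Data.Empty using (⊥)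
open import Data.Unit using (⊤)
open import Data.Sum using (_⊎_; inj₁; inj₂)
open import Data.Product using (Σ; _×_; _,_)
open import Relation.Binary.Core using (Rel)
open import Relation.Binary.Structures using (IsStrictTotalOrder)
open import Relation.Binary.PropositionalEquality using (_≡_)
open import Relation.Nullary using (¬_)

record RawOrd : Set₁ where
  field
    Carrier : Set
    _<_     : Rel Carrier 0ℓ
open RawOrd public

record LinOrd : Set₁ where
  field
    raw   : RawOrd
    isSTO : IsStrictTotalOrder {A = Carrier raw} _≡_ (_<_ raw)
open LinOrd public

-- φ ≤ ψ : there is an order embedding (strictly increasing map).
-- (For linear orders a strictly increasing map is injective and reflects order.)
_≼_ : RawOrd → RawOrd → Set
A ≼ B = Σ (Carrier A → Carrier B) λ f →
          ∀ x y → _<_ A x y → _<_ B (f x) (f y)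

𝟙 : RawOrd
𝟙 = record { Carrier = ⊤ ; _<_ = λ _ _ → ⊥ }

IsEmpty : RawOrd → Set
IsEmpty A = ¬ Carrier A

data SumLt (A B : RawOrd) : Carrier A ⊎ Carrier B → Carrier A ⊎ Carrier B → Set where
  ll : ∀ {x y} → _<_ A x y → SumLt A B (inj₁ x) (inj₁ y)
  rr : ∀ {x y} → _<_ B x y → SumLt A B (inj₂ x) (inj₂ y)
  lr : ∀ {x y} → SumLt A B (inj₁ x) (inj₂ y)

_⊕_ : RawOrd → RawOrd → RawOrd
A ⊕ B = record { Carrier = Carrier A ⊎ Carrier B ; _<_ = SumLt A B }

-- Product Y X : Y × X ordered anti-lexicographically
-- ((y,x) < (y',x') iff x < x', or x = x' and y < y').
data ProdLt (Y X : RawOrd) : Carrier Y × Carrier X → Carrier Y × Carrier X → Set where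
  second : ∀ {y y' x x'} → _<_ X x x' → ProdLt Y X (y , x) (y' , x')
  first  : ∀ {y y' x} → _<_ Y y y' → ProdLt Y X (y , x) (y' , x)

_⊗_ : RawOrd → RawOrd → RawOrd
Y ⊗ X = record { Carrier = Carrier Y × Carrier X ; _<_ = ProdLt Y X }

-- Let f embed ρτ in φψ and record in which copy of φ (a point of ψ) each point (r , t) lands.
-- Copies weakly increase along τ. If column t meets two copies, its lower point lies strictly
-- below every later column. If column t lies in a single copy and some later point lands in
-- that copy too, this copy of φ contains ρ + 1. So when ρ is nonempty and ρ + 1 ⋠ φ, every
-- column has a point strictly below all later columns, and these points embed τ in ψ. The
-- case 1 + ρ ⋠ φ is its mirror image under reversing all four orders; if ρ is empty then φ
-- is not, and 1 + ρ and ρ + 1 are single points.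
module Submission where

open import Defs
open import Level using (0ℓ)
open import Axiom.ExcludedMiddle using (ExcludedMiddle)
open import Data.Empty using (⊥-elim)
open import Data.Product using (Σ-syntax; _×_; _,_; proj₁; proj₂)
open import Data.Sum using (_⊎_; inj₁; inj₂)
open import Data.Unit using (⊤; tt)
open import Function using (flip)
open import Relation.Binary.PropositionalEquality using (_≡_; refl; sym; trans)
open import Relation.Binary.Structures using (IsStrictTotalOrder)
open import Relation.Binary.Definitions using (tri<; tri≈; tri>)
import Relation.Binary.Construct.Flip.EqAndOrd as Flip
open import Relation.Nullary using (¬_; yes; no)

constant-≼ : ∀ {A B} → (∀ x y → ¬ _<_ A x y) → Carrier B → A ≼ B
constant-≼ discrete b = (λ _ → b) , λ x y x<y → ⊥-elim (discrete x y x<y)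

𝟙⊕-discrete : ∀ {A} → IsEmpty A → ∀ x y → ¬ SumLt 𝟙 A x y
𝟙⊕-discrete empty _ _ (rr {x} _) = empty x
𝟙⊕-discrete empty _ _ (lr {y = y}) = empty y

⊕𝟙-discrete : ∀ {A} → IsEmpty A → ∀ x y → ¬ SumLt A 𝟙 x y
⊕𝟙-discrete empty _ _ (ll {x} _) = empty x
⊕𝟙-discrete empty _ _ (lr {x}) = empty x

infixl 30 _ᵒᵖ

_ᵒᵖ : RawOrd → RawOrd
A ᵒᵖ = record { Carrier = Carrier A ; _<_ = flip (_<_ A) }

reverse : LinOrd → LinOrd
reverse L = record { raw = raw L ᵒᵖ ; isSTO = Flip.isStrictTotalOrder (isSTO L) }

≼-ᵒᵖ : ∀ {A B} → A ≼ B → A ᵒᵖ ≼ B ᵒᵖ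
≼-ᵒᵖ (f , f-mono) = f , λ x y y<x → f-mono y x y<x

ProdLt-ᵒᵖ : ∀ {A B u v} → ProdLt A B u v → ProdLt (A ᵒᵖ) (B ᵒᵖ) v u
ProdLt-ᵒᵖ (second x<x′) = second x<x′
ProdLt-ᵒᵖ (first y<y′) = first y<y′

≼-⊗ᵒᵖ : ∀ {A B C D} → (A ⊗ B) ≼ (C ⊗ D) → (A ᵒᵖ ⊗ B ᵒᵖ) ≼ (C ᵒᵖ ⊗ D ᵒᵖ)
≼-⊗ᵒᵖ (f , f-mono) = f , λ u v u<v → ProdLt-ᵒᵖ (f-mono v u (ProdLt-ᵒᵖ u<v))

𝟙⊕-≼-fromᵒᵖ : ∀ {A B} → (A ᵒᵖ ⊕ 𝟙) ≼ B ᵒᵖ → (𝟙 ⊕ A) ≼ B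
𝟙⊕-≼-fromᵒᵖ {A} {B} (h , h-mono) = g , g-mono
  where
  g : ⊤ ⊎ Carrier A → Carrier B
  g (inj₁ _) = h (inj₂ tt)
  g (inj₂ a) = h (inj₁ a)

  g-mono : ∀ x y → SumLt 𝟙 A x y → _<_ B (g x) (g y)
  g-mono _ _ (rr a<a′) = h-mono _ _ (ll a<a′)
  g-mono _ _ lr = h-mono _ _ lr

module _ {A : RawOrd} (ψ : LinOrd) where

  open IsStrictTotalOrder (isSTO ψ) using (irrefl)

  outer-≤ : ∀ {u v} → ProdLt A (raw ψ) u v → _<_ (raw ψ) (proj₂ u) (proj₂ v) ⊎ proj₂ u ≡ proj₂ v
  outer-≤ (second y<y′) = inj₁ y<y′
  outer-≤ (first _) = inj₂ refl

  inner-< : ∀ {u v} → ProdLt A (raw ψ) u v → proj₂ u ≡ proj₂ v → _<_ A (proj₁ u) (proj₁ v)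
  inner-< (second y<y′) refl = ⊥-elim (irrefl refl y<y′)
  inner-< (first x<x′) _ = x<x′

module Columns {ρ τ φ : RawOrd} (ψ : LinOrd) (f : (ρ ⊗ τ) ≼ (φ ⊗ raw ψ)) where

  open IsStrictTotalOrder (isSTO ψ) using (compare) renaming (trans to <-trans)

  _<ψ_ : Carrier (raw ψ) → Carrier (raw ψ) → Set
  _<ψ_ = _<_ (raw ψ)

  copy : Carrier ρ → Carrier τ → Carrier (raw ψ)
  copy r t = proj₂ (proj₁ f (r , t))

  place : Carrier ρ → Carrier τ → Carrier φ
  place r t = proj₁ (proj₁ f (r , t))

  copy-mono : ∀ {r r′ t t′} → _<_ τ t t′ → copy r t <ψ copy r′ t′ ⊎ copy r t ≡ copy r′ t′
  copy-mono t<t′ = outer-≤ ψ (proj₂ f _ _ (second t<t′))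

  Spread : Carrier τ → Set
  Spread t = Σ[ r ∈ Carrier ρ ] Σ[ r′ ∈ Carrier ρ ] copy r t <ψ copy r′ t

  ¬spread⇒constant : ∀ {t} → ¬ Spread t → ∀ r r′ → copy r t ≡ copy r′ t
  ¬spread⇒constant {t} ¬spread r r′ with compare (copy r t) (copy r′ t)
  ... | tri< lt _ _ = ⊥-elim (¬spread (r , r′ , lt))
  ... | tri≈ _ eq _ = eq
  ... | tri> _ _ gt = ⊥-elim (¬spread (r′ , r , gt))

  constant-column-below : ¬ ((ρ ⊕ 𝟙) ≼ φ) → ∀ {t t′} → ¬ Spread t → _<_ τ t t′ →
                          ∀ r r′ → copy r t <ψ copy r′ t′
  constant-column-below ρ+1⋠φ {t} {t′} ¬spread t<t′ r r′ with copy-mono {r} {r′} t<t′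
  ... | inj₁ lt = lt
  ... | inj₂ eq = ⊥-elim (ρ+1⋠φ (h , h-mono))
    where
    same-copy : ∀ x → copy x t ≡ copy r′ t′
    same-copy x = trans (¬spread⇒constant ¬spread x r) eq

    h : Carrier ρ ⊎ _ → Carrier φ
    h (inj₁ x) = place x t
    h (inj₂ _) = place r′ t′

    h-mono : ∀ x y → SumLt ρ 𝟙 x y → _<_ φ (h x) (h y)
    h-mono _ _ (ll {x} {y} x<y) =
      inner-< ψ (proj₂ f _ _ (first x<y)) (trans (same-copy x) (sym (same-copy y)))
    h-mono _ _ (lr {x}) = inner-< ψ (proj₂ f _ _ (second t<t′)) (same-copy x)

  point-below-later-columns : ExcludedMiddle 0ℓ → Carrier ρ → ¬ ((ρ ⊕ 𝟙) ≼ φ) → ∀ t →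
    Σ[ r ∈ Carrier ρ ] (∀ {t′} r′ → _<_ τ t t′ → copy r t <ψ copy r′ t′)
  point-below-later-columns em r₀ ρ+1⋠φ t with em {Spread t}
  ... | yes (r , r″ , lt) = r , λ r′ t<t′ → below (copy-mono {r″} {r′} t<t′)
    where
    below : ∀ {c} → copy r″ t <ψ c ⊎ copy r″ t ≡ c → copy r t <ψ c
    below (inj₁ gt) = <-trans lt gt
    below (inj₂ refl) = lt
  ... | no ¬spread = r₀ , λ r′ t<t′ → constant-column-below ρ+1⋠φ ¬spread t<t′ r₀ r′

≼-⊗-rightFactor : ExcludedMiddle 0ℓ → ∀ {ρ τ φ} (ψ : LinOrd) → Carrier ρ → ¬ ((ρ ⊕ 𝟙) ≼ φ) →
                  (ρ ⊗ τ) ≼ (φ ⊗ raw ψ) → τ ≼ raw ψ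
≼-⊗-rightFactor em {ρ} {τ} ψ r₀ ρ+1⋠φ f =
  (λ t → copy (lowest t) t) , λ t t′ t<t′ → proj₂ (point-below t) (lowest t′) t<t′
  where
  open Columns ψ f
  point-below : ∀ t → Σ[ r ∈ Carrier ρ ] (∀ {t′} r′ → _<_ τ t t′ → copy r t <ψ copy r′ t′)
  point-below = point-below-later-columns em r₀ ρ+1⋠φ

  lowest : Carrier τ → Carrier ρ
  lowest t = proj₁ (point-below t)

≼-⊗-rightFactor′ : ExcludedMiddle 0ℓ → ∀ {ρ τ φ} (ψ : LinOrd) → Carrier ρ → ¬ ((𝟙 ⊕ ρ) ≼ φ) →
                   (ρ ⊗ τ) ≼ (φ ⊗ raw ψ) → τ ≼ raw ψ
≼-⊗-rightFactor′ em {ρ} {τ} {φ} ψ r₀ 1+ρ⋠φ f =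
  ≼-ᵒᵖ {τ ᵒᵖ} {raw ψ ᵒᵖ} (≼-⊗-rightFactor em (reverse ψ) r₀ ρᵒᵖ+1⋠φᵒᵖ (≼-⊗ᵒᵖ f))
  where
  ρᵒᵖ+1⋠φᵒᵖ : ¬ ((ρ ᵒᵖ ⊕ 𝟙) ≼ φ ᵒᵖ)
  ρᵒᵖ+1⋠φᵒᵖ h = 1+ρ⋠φ (𝟙⊕-≼-fromᵒᵖ {ρ} {φ} h)

proposition4p6 : ExcludedMiddle 0ℓ →
    (ρ τ φ ψ : LinOrd) →
    ¬ (IsEmpty (raw ρ) × IsEmpty (raw φ)) →
    (raw ρ ⊗ raw τ) ≼ (raw φ ⊗ raw ψ) →
    (((𝟙 ⊕ raw ρ) ≼ raw φ) × ((raw ρ ⊕ 𝟙) ≼ raw φ)) ⊎ (raw τ ≼ raw ψ)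
proposition4p6 em ρ τ φ ψ nonempty f with em {Carrier (raw ρ)}
... | no ρ-empty with em {Carrier (raw φ)}
...   | yes x = inj₁ ( constant-≼ {B = raw φ} (𝟙⊕-discrete ρ-empty) x
                   , constant-≼ {B = raw φ} (⊕𝟙-discrete ρ-empty) x )
...   | no φ-empty = ⊥-elim (nonempty (ρ-empty , φ-empty))
proposition4p6 em ρ τ φ ψ nonempty f | yes r₀
  with em {(𝟙 ⊕ raw ρ) ≼ raw φ} | em {(raw ρ ⊕ 𝟙) ≼ raw φ}
... | yes 1+ρ≼φ | yes ρ+1≼φ = inj₁ (1+ρ≼φ , ρ+1≼φ)
... | no 1+ρ⋠φ | _ = inj₂ (≼-⊗-rightFactor′ em ψ r₀ 1+ρ⋠φ f)
... | _ | no ρ+1⋠φ = inj₂ (≼-⊗-rightFactor em ψ r₀ ρ+1⋠φ f)
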